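{- The function $P:\mathcal{C}\to H_{\mathcal{C}}$, $[C]\mapsto P_C$, is multiplicative with respect to disjoint union: for all multi-complexes $C_1,C_2$, $P_{C_1\sqcup C_2}=P_{C_1}\cdot P_{C_2}$ in $H_{\mathcal{C}}$.
   Context: A multiset based on a set $S$ is a function $S\to\{1,2,3,\dots\}$; $S$ is its support $\mathrm{supp}$. A multi-complex $C$ consists of a finite base set $n_C$, a finite family $\{A_i\}_{i\in I}$ of non-empty multisets (repetitions allowed) whose supports are subsets of $n_C$, and a partial order $\preceq$ on this family such that (1) for each $k\in n_C$ the singleton $\{k\}$ occurs exactly once among the $A_i$, and $\{k\}\preceq A_i$ iff $k$ belongs to $A_i$; (2) if $A_i\preceq A_j$ then $A_i$ is contained in $A_j$. The empty family is the unique multi-complex on $\emptyset$. Isomorphism: bijection of base sets inducing a bijection of families preserving and reflecting $\preceq$; $\mathcal{C}$ is the set of isomorphism classes. A sub-multi-complex is a downward closed subfamily with inherited order; $D\preceq C$ means $D$ is a sub-multi-complex of $C$ with $n_D=n_C$. Disjoint union $C\sqcup D$: base set $n_C\sqcup n_D$, disjoint union of families, induced order. $H_{\mathcal{C}}$ is the algebra over a field $k$ of characteristic $0$ with basis $\mathcal{C}$ and product $[C][D]=[C\sqcup D]$. For a multi-complex $C$, let $X_C=\{D: D\preceq C\}$ ordered by being a sub-multi-complex, with Möbius function $\mu_P$, and define $P_C=\sum_{D\preceq C}\mu_P(D,C)\,[D]\in H_{\mathcal{C}}$, the sum running over all such sub-multi-complexes $D$ (not isomorphism classes); $P_C$ depends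 only on the isomorphism class of $C$. -}

module Defs where

open import Data.Nat as ℕ using (ℕ; zero; suc; _≤_; _≡ᵇ_)
open import Data.Fin as Fin using (Fin; splitAt)
open import Data.Fin.Properties using () renaming (_≟_ to _≟ᶠ_)
open import Data.Bool using (Bool; true; false; _∧_; _∨_; not; if_then_else_; T)
open import Data.Sum using (_⊎_; inj₁; inj₂)
open import Data.Product using (Σ; ∃; _×_; _,_)
open import Data.List as List using (List; []; _∷_; _++_; map; concatMap; foldr; length; filterᵇ; allFin)
open import Data.Vec as Vec using (Vec; lookup; replicate)
open import Data.Vec.Properties using () renaming (≡-dec to ≡-decVec)
open import Data.Integer as ℤ using (ℤ; +_; -_)
open import Function.Bundles using (_↔_; Inverse)
open import Relation.Nullary using (¬_; does)
open import Relation.Nullary.Decidable using (⌊_⌋)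
open import Relation.Binary.PropositionalEquality using (_≡_; _≢_)
open import Data.Bool.Properties using () renaming (_≟_ to _≟ᵇ_)

-- A multiset whose support is a subset of the base set Fin n, given by its
-- multiplicity function (multiplicity 0 = not in the support).
Multiset : ℕ → Set
Multiset n = Fin n → ℕ

_∈ₘ_ : ∀ {n} → Fin n → Multiset n → Set
k ∈ₘ A = A k ≢ 0

IsSingletonOf : ∀ {n} → Fin n → Multiset n → Set
IsSingletonOf k A = ∀ k′ → A k′ ≡ (if ⌊ k ≟ᶠ k′ ⌋ then 1 else 0)

_⊆ₘ_ : ∀ {n} → Multiset n → Multiset n → Set
A ⊆ₘ B = ∀ k → A k ≤ B k

-- Raw data of a multi-complex: base set n_C = Fin base,
-- family {A_i}_{i ∈ Fin size}, and a relation le i j meaning A_i ≼ A_j.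
record RawMC : Set where
  constructor mkMC
  field
    base : ℕ
    size : ℕ
    fam  : Fin size → Multiset base
    le   : Fin size → Fin size → Bool
open RawMC public

record IsMultiComplex (C : RawMC) : Set where
  field
    nonEmpty : ∀ i → ∃ λ k → k ∈ₘ fam C i
    refl     : ∀ i → le C i i ≡ true
    antisym  : ∀ i j → le C i j ≡ true → le C j i ≡ true → i ≡ j
    trans    : ∀ i j l → le C i j ≡ true → le C j l ≡ true → le C i l ≡ true
    singletonExists : ∀ k → ∃ λ i → IsSingletonOf k (fam C i)
    singletonUnique : ∀ k i j → IsSingletonOf k (fam C i) → IsSingletonOf k (fam C j) → i ≡ j
    singletonLe₁ : ∀ k i j → IsSingletonOf k (fam C i) → le C i j ≡ true → k ∈ₘ fam C j
    singletonLe₂ : ∀ k i j → IsSingletonOf k (fam C i) → k ∈ₘ fam C j → le C i j ≡ true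
    leContained : ∀ i j → le C i j ≡ true → fam C i ⊆ₘ fam C j

record _≅_ (C D : RawMC) : Set where
  field
    σ : Fin (base C) ↔ Fin (base D)
    τ : Fin (size C) ↔ Fin (size D)
    famIso : ∀ i k → fam D (Inverse.to τ i) (Inverse.to σ k) ≡ fam C i k
    leIso  : ∀ i j → le D (Inverse.to τ i) (Inverse.to τ j) ≡ le C i j

_⊔_ : RawMC → RawMC → RawMC
C ⊔ D = mkMC (base C ℕ.+ base D) (size C ℕ.+ size D) f r
  where
  f : Fin (size C ℕ.+ size D) → Multiset (base C ℕ.+ base D)
  f i k with splitAt (size C) i | splitAt (base C) k
  ... | inj₁ i′ | inj₁ k′ = fam C i′ k′
  ... | inj₂ i′ | inj₂ k′ = fam D i′ k′
  ... | _       | _       = 0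
  r : Fin (size C ℕ.+ size D) → Fin (size C ℕ.+ size D) → Bool
  r i j with splitAt (size C) i | splitAt (size C) j
  ... | inj₁ i′ | inj₁ j′ = le C i′ j′
  ... | inj₂ i′ | inj₂ j′ = le D i′ j′
  ... | _       | _       = false

-- Sub-multi-complexes D ≼ C (same base set), as subsets of the index set

Subfamily : ℕ → Set
Subfamily m = Vec Bool m

allSubfamilies : ∀ m → List (Subfamily m)
allSubfamilies zero    = Vec.[] ∷ []
allSubfamilies (suc m) = map (true Vec.∷_) (allSubfamilies m) ++ map (false Vec.∷_) (allSubfamilies m)

allᵇ : ∀ {A : Set} → (A → Bool) → List A → Bool
allᵇ p = foldr (λ x b → p x ∧ b) true

anyᵇ : ∀ {A : Set} → (A → Bool) → List A → Bool
anyᵇ p = foldr (λ x b → p x ∨ b) false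

_⇒ᵇ_ : Bool → Bool → Bool
a ⇒ᵇ b = not a ∨ b

isSingletonOfᵇ : ∀ {n} → Fin n → Multiset n → Bool
isSingletonOfᵇ {n} k A = allᵇ (λ k′ → A k′ ≡ᵇ (if ⌊ k ≟ᶠ k′ ⌋ then 1 else 0)) (allFin n)

isSingletonᵇ : ∀ {n} → Multiset n → Bool
isSingletonᵇ {n} A = anyᵇ (λ k → isSingletonOfᵇ k A) (allFin n)

isSubMCᵇ : (C : RawMC) → Subfamily (size C) → Bool
isSubMCᵇ C S =
  allᵇ (λ i → allᵇ (λ j → (le C i j ∧ lookup S j) ⇒ᵇ lookup S i) (allFin (size C))) (allFin (size C))
  ∧ allᵇ (λ i → isSingletonᵇ (fam C i) ⇒ᵇ lookup S i) (allFin (size C))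

-- the elements of X_C, each listed exactly once
X : (C : RawMC) → List (Subfamily (size C))
X C = filterᵇ (isSubMCᵇ C) (allSubfamilies (size C))

-- the order of X_C (being a sub-multi-complex = inclusion of subfamilies)
_⊆ᵇ_ : ∀ {m} → Subfamily m → Subfamily m → Bool
_⊆ᵇ_ {m} S T = allᵇ (λ i → lookup S i ⇒ᵇ lookup T i) (allFin m)

-- the full family, i.e. C itself as an element of X_C
top : ∀ m → Subfamily m
top m = replicate m true

-- the sub-multi-complex determined by S (indices in increasing order)
restrict : (C : RawMC) → Subfamily (size C) → RawMC
restrict C S = mkMC (base C) (length L) (λ j → fam C (List.lookup L j))
                    (λ j j′ → le C (List.lookup L j) (List.lookup L j′))
  where L = filterᵇ (lookup S) (allFin (size C))

sumℤ : List ℤ → ℤ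
sumℤ = foldr ℤ._+_ (+ 0)

MobFun : RawMC → Set
MobFun C = Subfamily (size C) → Subfamily (size C) → ℤ

record IsMöbius (C : RawMC) (μ : MobFun C) : Set where
  field
    diag : ∀ x → T (isSubMCᵇ C x) → μ x x ≡ + 1
    offDiag : ∀ x y → T (isSubMCᵇ C x) → T (isSubMCᵇ C y) → T (x ⊆ᵇ y) → x ≢ y →
              sumℤ (map (μ x) (filterᵇ (λ z → (x ⊆ᵇ z) ∧ (z ⊆ᵇ y)) (X C))) ≡ + 0

-- The algebra H_C (over ℤ): formal ℤ-linear combinations of multi-complexes,
-- two combinations being equal iff they have the same coefficient on every
-- isomorphism class, i.e. iff every isomorphism-invariant function agrees
-- on them after linear extension.

H : Set
H = List (ℤ × RawMC)

evalH : (RawMC → ℤ) → H → ℤ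
evalH f = foldr (λ { (a , C) s → a ℤ.* f C ℤ.+ s }) (+ 0)

_≈H_ : H → H → Set
x ≈H y = (f : RawMC → ℤ) → (∀ C D → C ≅ D → f C ≡ f D) → evalH f x ≡ evalH f y

_·H_ : H → H → H
x ·H y = concatMap (λ { (a , C) → map (λ { (b , D) → (a ℤ.* b , C ⊔ D) }) y }) x

P : (C : RawMC) → MobFun C → H
P C μ = map (λ S → (μ S (top (size C)) , restrict C S)) (X C)

-- A sub-multi-complex of C₁ ⊔ C₂ with full base set is exactly a union D₁ ⊔ D₂ of such
-- sub-multi-complexes of the two parts, ordered componentwise, so X_{C₁ ⊔ C₂} is the product
-- poset X_{C₁} × X_{C₂}. The product μ₁ · μ₂ satisfies the defining recursion of the Möbius
-- function of this product, whose solution is unique, and restricting C₁ ⊔ C₂ to D₁ ⊔ D₂ gives a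
-- multi-complex isomorphic to D₁ ⊔ D₂. Both sides therefore expand to the same double sum
-- Σ μ₁(D₁, C₁) μ₂(D₂, C₂) [D₁ ⊔ D₂].

module Submission where

open import Defs
open import Data.Bool using (Bool; true; false; _∧_; T; if_then_else_)
open import Data.Bool.Properties as Boolₚ using (T-∧; T-∨)
open import Data.Empty using (⊥-elim)
open import Data.Fin as Fin using (Fin; splitAt; _↑ˡ_; _↑ʳ_)
import Data.Fin.Properties as Finₚ
import Data.List as List
open import Data.List using (List; []; _∷_; _++_; map; length; filter; allFin; filterᵇ; cartesianProductWith)
import Data.List.Membership.Propositional.Properties as ∈ₚ
import Data.List.Properties as Listₚ
open import Data.List.Membership.Propositional using (_∈_)
open import Data.List.Relation.Unary.All as All using (All; []; _∷_)
import Data.List.Relation.Unary.All.Properties as Allₚ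
open import Data.List.Relation.Unary.Any using (Any; here; there)
import Data.List.Relation.Unary.Any.Properties as Anyₚ
open import Data.Nat using (ℕ; zero; suc; _+_; _≤_; _<_; z≤n; s≤s)
open import Data.Integer as ℤ using (ℤ; +_)
import Data.Integer.Properties as ℤₚ
open import Data.Integer.Tactic.RingSolver using (solve-∀)
open import Data.Vec as Vec using (Vec; lookup)
import Data.Vec.Properties as Vecₚ
import Data.Nat.Properties as ℕₚ
open import Data.Product using (∃; _×_; _,_; proj₁; proj₂)
open import Data.Sum using (_⊎_; inj₁; inj₂; [_,_]′)
open import Data.Unit using (tt)
open import Function using (_∘_; id)
import Algebra.Properties.CommutativeSemigroup
open import Algebra.Bundles using (CommutativeMonoid)
open import Function.Definitions using (Injective)
open import Function.Bundles using (_⇔_; mk⇔; Equivalence; _↔_; mk↔ₛ′)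
open import Function.Construct.Identity using (↔-id)
open import Relation.Binary.PropositionalEquality
open import Relation.Nullary using (yes; no)
open import Relation.Binary.Definitions using (DecidableEquality)
open import Relation.Nullary.Decidable using (⌊_⌋; T?)

open Equivalence using (to; from)

T-injective : ∀ {a b} → (T a ⇔ T b) → a ≡ b
T-injective {false} {false} _ = refl
T-injective {false} {true}  a⇔b = ⊥-elim (from a⇔b tt)
T-injective {true}  {false} a⇔b = ⊥-elim (to a⇔b tt)
T-injective {true}  {true}  _ = refl

T-⇒ᵇ : ∀ a b → T (a ⇒ᵇ b) ⇔ (T a → T b)
T-⇒ᵇ false b = mk⇔ (λ _ ()) (λ _ → tt)
T-⇒ᵇ true  b = mk⇔ (λ t _ → t) (λ f → f tt)

module _ {A : Set} (p : A → Bool) where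

  T-allᵇ : ∀ xs → T (allᵇ p xs) ⇔ All (T ∘ p) xs
  T-allᵇ []       = mk⇔ (λ _ → []) (λ _ → tt)
  T-allᵇ (x ∷ xs) = mk⇔
    (λ t → let px , pxs = to T-∧ t in px ∷ to (T-allᵇ xs) pxs)
    (λ { (px ∷ pxs) → from T-∧ (px , from (T-allᵇ xs) pxs) })

  T-anyᵇ : ∀ xs → T (anyᵇ p xs) ⇔ Any (T ∘ p) xs
  T-anyᵇ []       = mk⇔ (λ ()) (λ ())
  T-anyᵇ (x ∷ xs) = mk⇔
    ([ here , there ∘ to (T-anyᵇ xs) ]′ ∘ to T-∨)
    (λ { (here px) → from T-∨ (inj₁ px) ; (there pxs) → from T-∨ (inj₂ (from (T-anyᵇ xs) pxs)) })

module _ {n} (p : Fin n → Bool) where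

  T-allᵇ-allFin : T (allᵇ p (allFin n)) ⇔ (∀ i → T (p i))
  T-allᵇ-allFin = mk⇔ (Allₚ.tabulate⁻ ∘ to (T-allᵇ p _)) (from (T-allᵇ p _) ∘ Allₚ.tabulate⁺)

  T-anyᵇ-allFin : T (anyᵇ p (allFin n)) ⇔ (∃ λ i → T (p i))
  T-anyᵇ-allFin = mk⇔ (Anyₚ.tabulate⁻ ∘ to (T-anyᵇ p _)) (λ (i , t) → from (T-anyᵇ p _) (Anyₚ.tabulate⁺ i t))

module _ {A B C D : Set} where

  map-cartesianProductWith : ∀ (g : C → D) (f : A → B → C) xs ys →
    map g (cartesianProductWith f xs ys) ≡ cartesianProductWith (λ x y → g (f x y)) xs ys
  map-cartesianProductWith g f []       ys = refl
  map-cartesianProductWith g f (x ∷ xs) ys = trans (Listₚ.map-++ g (map (f x) ys) _)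
    (cong₂ _++_ (sym (Listₚ.map-∘ ys)) (map-cartesianProductWith g f xs ys))

  cartesianProductWith-mapˡ : ∀ (f : B → C → D) (h : A → B) xs ys →
    cartesianProductWith f (map h xs) ys ≡ cartesianProductWith (f ∘ h) xs ys
  cartesianProductWith-mapˡ f h []       ys = refl
  cartesianProductWith-mapˡ f h (x ∷ xs) ys = cong (map (f (h x)) ys ++_) (cartesianProductWith-mapˡ f h xs ys)

  cartesianProductWith-mapʳ : ∀ (f : A → C → D) (h : B → C) xs ys →
    cartesianProductWith f xs (map h ys) ≡ cartesianProductWith (λ x y → f x (h y)) xs ys
  cartesianProductWith-mapʳ f h []       ys = refl
  cartesianProductWith-mapʳ f h (x ∷ xs) ys = cong₂ _++_ (sym (Listₚ.map-∘ ys)) (cartesianProductWith-mapʳ f h xs ys)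

module _ {A B C : Set} where

  cartesianProductWith-++ : ∀ (f : A → B → C) xs xs′ ys →
    cartesianProductWith f (xs ++ xs′) ys ≡ cartesianProductWith f xs ys ++ cartesianProductWith f xs′ ys
  cartesianProductWith-++ f []       xs′ ys = refl
  cartesianProductWith-++ f (x ∷ xs) xs′ ys = trans (cong (map (f x) ys ++_) (cartesianProductWith-++ f xs xs′ ys))
    (sym (Listₚ.++-assoc (map (f x) ys) _ _))

  cartesianProductWith-cong : ∀ {f g : A → B → C} {xs ys} → (∀ {x y} → x ∈ xs → y ∈ ys → f x y ≡ g x y) →
    cartesianProductWith f xs ys ≡ cartesianProductWith g xs ys
  cartesianProductWith-cong {xs = []}     f≡g = refl
  cartesianProductWith-cong {xs = x ∷ xs} f≡g = cong₂ _++_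
    (Listₚ.map-cong-local (All.tabulate (f≡g (here refl))))
    (cartesianProductWith-cong (f≡g ∘ there))

module _ {A B : Set} where

  filterᵇ-map : ∀ (p : B → Bool) (f : A → B) xs → filterᵇ p (map f xs) ≡ map f (filterᵇ (p ∘ f) xs)
  filterᵇ-map p f []       = refl
  filterᵇ-map p f (x ∷ xs) with p (f x)
  ... | true  = cong (f x ∷_) (filterᵇ-map p f xs)
  ... | false = filterᵇ-map p f xs

filterᵇ-cong : ∀ {A : Set} {p q : A → Bool} → (∀ x → p x ≡ q x) → ∀ xs → filterᵇ p xs ≡ filterᵇ q xs
filterᵇ-cong p≡q = Listₚ.filter-≐ (T? ∘ _) (T? ∘ _) ((λ {x} → subst T (p≡q x)) , (λ {x} → subst T (sym (p≡q x))))

module _ {A B C : Set} (p : C → Bool) (q : A → Bool) (r : B → Bool) (f : A → B → C)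
         (p∘f≡q∧r : ∀ x y → p (f x y) ≡ (q x ∧ r y)) where

  filterᵇ-cartesianProductWith : ∀ xs ys →
    filterᵇ p (cartesianProductWith f xs ys) ≡ cartesianProductWith f (filterᵇ q xs) (filterᵇ r ys)
  filterᵇ-cartesianProductWith []       ys = refl
  filterᵇ-cartesianProductWith (x ∷ xs) ys = begin
      filterᵇ p (map (f x) ys ++ cartesianProductWith f xs ys)
    ≡⟨ Listₚ.filter-++ (T? ∘ p) (map (f x) ys) _ ⟩
      filterᵇ p (map (f x) ys) ++ filterᵇ p (cartesianProductWith f xs ys)
    ≡⟨ cong₂ _++_ (trans (filterᵇ-map p (f x) ys) (cong (map (f x)) (filterᵇ-cong (p∘f≡q∧r x) ys)))
                  (filterᵇ-cartesianProductWith xs ys) ⟩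
      map (f x) (filterᵇ (λ y → q x ∧ r y) ys) ++ cartesianProductWith f (filterᵇ q xs) (filterᵇ r ys)
    ≡⟨ select ⟩
      cartesianProductWith f (filterᵇ q (x ∷ xs)) (filterᵇ r ys)
    ∎
    where
    open ≡-Reasoning
    select : map (f x) (filterᵇ (λ y → q x ∧ r y) ys) ++ cartesianProductWith f (filterᵇ q xs) (filterᵇ r ys)
           ≡ cartesianProductWith f (filterᵇ q (x ∷ xs)) (filterᵇ r ys)
    select with q x
    ... | true  = refl
    ... | false = cong (λ zs → map (f x) zs ++ cartesianProductWith f (filterᵇ q xs) (filterᵇ r ys))
                       (Listₚ.filter-none (T? ∘ λ _ → false) (All.universal (λ _ ()) ys))

sumℤ-++ : ∀ xs ys → sumℤ (xs ++ ys) ≡ sumℤ xs ℤ.+ sumℤ ys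
sumℤ-++ []       ys = sym (ℤₚ.+-identityˡ (sumℤ ys))
sumℤ-++ (x ∷ xs) ys = trans (cong (λ s → x ℤ.+ s) (sumℤ-++ xs ys)) (sym (ℤₚ.+-assoc x (sumℤ xs) (sumℤ ys)))

module _ {A B : Set} (h : A → ℤ) (k : B → ℤ) where

  sumℤ-map-*ˡ : ∀ c ys → sumℤ (map (λ y → c ℤ.* k y) ys) ≡ c ℤ.* sumℤ (map k ys)
  sumℤ-map-*ˡ c []       = sym (ℤₚ.*-zeroʳ c)
  sumℤ-map-*ˡ c (y ∷ ys) = trans (cong (λ s → c ℤ.* k y ℤ.+ s) (sumℤ-map-*ˡ c ys)) (sym (ℤₚ.*-distribˡ-+ c (k y) _))

  sumℤ-cartesianProductWith-* : ∀ xs ys →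
    sumℤ (cartesianProductWith (λ x y → h x ℤ.* k y) xs ys) ≡ sumℤ (map h xs) ℤ.* sumℤ (map k ys)
  sumℤ-cartesianProductWith-* []       ys = sym (ℤₚ.*-zeroˡ (sumℤ (map k ys)))
  sumℤ-cartesianProductWith-* (x ∷ xs) ys = begin
      sumℤ (map (λ y → h x ℤ.* k y) ys ++ cartesianProductWith (λ x y → h x ℤ.* k y) xs ys)
    ≡⟨ sumℤ-++ (map (λ y → h x ℤ.* k y) ys) _ ⟩
      sumℤ (map (λ y → h x ℤ.* k y) ys) ℤ.+ sumℤ (cartesianProductWith (λ x y → h x ℤ.* k y) xs ys)
    ≡⟨ cong₂ ℤ._+_ (sumℤ-map-*ˡ (h x) ys) (sumℤ-cartesianProductWith-* xs ys) ⟩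
      h x ℤ.* sumℤ (map k ys) ℤ.+ sumℤ (map h xs) ℤ.* sumℤ (map k ys)
    ≡⟨ ℤₚ.*-distribʳ-+ (sumℤ (map k ys)) (h x) _ ⟨
      (h x ℤ.+ sumℤ (map h xs)) ℤ.* sumℤ (map k ys)
    ∎
    where open ≡-Reasoning

module _ {A : Set} (_≟_ : DecidableEquality A) (g h : A → ℤ) (y : A) where

  sum-difference : ∀ xs → (∀ {z} → z ∈ xs → y ≢ z → g z ≡ h z) →
    sumℤ (map g xs) ℤ.- sumℤ (map h xs) ≡ + length (filter (y ≟_) xs) ℤ.* (g y ℤ.- h y)
  sum-difference []       _      = sym (ℤₚ.*-zeroˡ (g y ℤ.- h y))
  sum-difference (z ∷ xs) g≡h with y ≟ z
  ... | yes refl = begin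
      (g y ℤ.+ Σg) ℤ.- (h y ℤ.+ Σh)      ≡⟨ regroup (g y) (h y) Σg Σh ⟩
      (Σg ℤ.- Σh) ℤ.+ (g y ℤ.- h y)      ≡⟨ cong (ℤ._+ (g y ℤ.- h y)) (sum-difference xs (g≡h ∘ there)) ⟩
      c ℤ.* (g y ℤ.- h y) ℤ.+ (g y ℤ.- h y) ≡⟨ count-suc c (g y ℤ.- h y) ⟩
      (+ 1 ℤ.+ c) ℤ.* (g y ℤ.- h y)    ∎
    where
    open ≡-Reasoning
    Σg = sumℤ (map g xs)
    Σh = sumℤ (map h xs)
    c = + length (filter (y ≟_) xs)
    regroup : ∀ a b s t → (a ℤ.+ s) ℤ.- (b ℤ.+ t) ≡ (s ℤ.- t) ℤ.+ (a ℤ.- b)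
    regroup = solve-∀
    count-suc : ∀ c d → c ℤ.* d ℤ.+ d ≡ (+ 1 ℤ.+ c) ℤ.* d
    count-suc = solve-∀
  ... | no y≢z = begin
      (g z ℤ.+ Σg) ℤ.- (h z ℤ.+ Σh)      ≡⟨ cong (λ t → (t ℤ.+ Σg) ℤ.- (h z ℤ.+ Σh)) (g≡h (here refl) y≢z) ⟩
      (h z ℤ.+ Σg) ℤ.- (h z ℤ.+ Σh)      ≡⟨ cancel (h z) Σg Σh ⟩
      Σg ℤ.- Σh                          ≡⟨ sum-difference xs (g≡h ∘ there) ⟩
      + length (filter (y ≟_) xs) ℤ.* (g y ℤ.- h y) ∎
    where
    open ≡-Reasoning
    Σg = sumℤ (map g xs)
    Σh = sumℤ (map h xs)
    cancel : ∀ a s t → (a ℤ.+ s) ℤ.- (a ℤ.+ t) ≡ s ℤ.- t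
    cancel = solve-∀

  -- xs may contain y several times; only its multiplicity being positive matters.
  ≡-from-sums : ∀ {xs} → y ∈ xs → (∀ {z} → z ∈ xs → y ≢ z → g z ≡ h z) →
    sumℤ (map g xs) ≡ sumℤ (map h xs) → g y ≡ h y
  ≡-from-sums {xs} y∈xs g≡h Σg≡Σh with length (filter (y ≟_) xs) in multiplicity | Listₚ.filter-some (y ≟_) y∈xs
  ... | suc c | _ = ℤₚ.i-j≡0⇒i≡j (g y) (h y) (ℤₚ.*-cancelˡ-≡ (+ suc c) _ (+ 0) (begin
      + suc c ℤ.* (g y ℤ.- h y)       ≡⟨ cong (λ n → + n ℤ.* (g y ℤ.- h y)) multiplicity ⟨
      + length (filter (y ≟_) xs) ℤ.* (g y ℤ.- h y) ≡⟨ sum-difference xs g≡h ⟨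
      sumℤ (map g xs) ℤ.- sumℤ (map h xs)  ≡⟨ ℤₚ.i≡j⇒i-j≡0 Σg≡Σh ⟩
      + 0                             ≡⟨ ℤₚ.*-zeroʳ (+ suc c) ⟨
      + suc c ℤ.* + 0                 ∎))
    where open ≡-Reasoning

data SplitView (m n : ℕ) : Fin (m + n) → Set where
  left  : ∀ i → SplitView m n (i ↑ˡ n)
  right : ∀ j → SplitView m n (m ↑ʳ j)

splitView : ∀ m n i → SplitView m n i
splitView m n i = subst (SplitView m n) (Finₚ.join-splitAt m n i) (fromSum (splitAt m i))
  where
  fromSum : ∀ s → SplitView m n (Fin.join m n s)
  fromSum (inj₁ i) = left i
  fromSum (inj₂ j) = right j

tabulate-+ : ∀ {A : Set} m {n} (f : Fin (m + n) → A) →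
  List.tabulate f ≡ List.tabulate (f ∘ (_↑ˡ n)) ++ List.tabulate (f ∘ (m ↑ʳ_))
tabulate-+ zero    f = refl
tabulate-+ (suc m) f = cong (f Fin.zero ∷_) (tabulate-+ m (f ∘ Fin.suc))

allFin-+ : ∀ m n → allFin (m + n) ≡ map (_↑ˡ n) (allFin m) ++ map (m ↑ʳ_) (allFin n)
allFin-+ m n = trans (tabulate-+ m id) (sym (cong₂ _++_ (Listₚ.map-tabulate id (_↑ˡ n)) (Listₚ.map-tabulate id (m ↑ʳ_))))

++-elim : ∀ {A : Set} {m n} (P : Vec A (m + n) → Set) → (∀ u v → P (u Vec.++ v)) → ∀ x → P x
++-elim {m = m} P P-++ x = subst P (Vecₚ.take++drop≡id m x) (P-++ (Vec.take m x) (Vec.drop m x))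

take-++ : ∀ {A : Set} {m n} (u : Vec A m) (v : Vec A n) → Vec.take m (u Vec.++ v) ≡ u
take-++ {m = m} u v = Vecₚ.++-injectiveˡ (Vec.take m (u Vec.++ v)) u (Vecₚ.take++drop≡id m (u Vec.++ v))

drop-++ : ∀ {A : Set} {m n} (u : Vec A m) (v : Vec A n) → Vec.drop m (u Vec.++ v) ≡ v
drop-++ {m = m} u v = Vecₚ.++-injectiveʳ (Vec.take m (u Vec.++ v)) u (Vecₚ.take++drop≡id m (u Vec.++ v))

top-+ : ∀ m n → top (m + n) ≡ top m Vec.++ top n
top-+ zero    n = refl
top-+ (suc m) n = cong (true Vec.∷_) (top-+ m n)

-- Singletons and sub-multi-complexes

δ : ∀ {n} → Fin n → Fin n → ℕ
δ k k′ = if ⌊ k Finₚ.≟ k′ ⌋ then 1 else 0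

δ-refl : ∀ {n} (k : Fin n) → δ k k ≡ 1
δ-refl k with k Finₚ.≟ k
... | yes _   = refl
... | no k≢k = ⊥-elim (k≢k refl)

δ-≢ : ∀ {n} {k k′ : Fin n} → k ≢ k′ → δ k k′ ≡ 0
δ-≢ {k = k} {k′} k≢k′ with k Finₚ.≟ k′
... | yes k≡k′ = ⊥-elim (k≢k′ k≡k′)
... | no _     = refl

δ-injective : ∀ {m n} {ι : Fin m → Fin n} → Injective _≡_ _≡_ ι → ∀ k k′ → δ (ι k) (ι k′) ≡ δ k k′
δ-injective {ι = ι} ι-inj k k′ with k Finₚ.≟ k′ | ι k Finₚ.≟ ι k′
... | yes _    | yes _   = refl
... | no _     | no _    = refl
... | yes refl | no ≢    = ⊥-elim (≢ refl)
... | no ≢     | yes ≡ι  = ⊥-elim (≢ (ι-inj ≡ι))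

IsSingleton : ∀ {n} → Multiset n → Set
IsSingleton A = ∃ λ k → IsSingletonOf k A

T-isSingletonᵇ : ∀ {n} (A : Multiset n) → T (isSingletonᵇ A) ⇔ IsSingleton A
T-isSingletonᵇ A = mk⇔
  (λ t → let k , tk = to (T-anyᵇ-allFin _) t
         in k , λ k′ → ℕₚ.≡ᵇ⇒≡ _ _ (to (T-allᵇ-allFin _) tk k′))
  (λ (k , A≡δ) → from (T-anyᵇ-allFin _) (k , from (T-allᵇ-allFin _) (λ k′ → ℕₚ.≡⇒≡ᵇ _ _ (A≡δ k′))))

IsSingleton-embed : ∀ {m n} {A : Multiset m} {B : Multiset n} (ι : Fin m → Fin n) →
  Injective _≡_ _≡_ ι → (∀ k → B (ι k) ≡ A k) → (∀ k → (∃ λ k′ → ι k′ ≡ k) ⊎ B k ≡ 0) →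
  IsSingleton B ⇔ IsSingleton A
IsSingleton-embed {A = A} {B} ι ι-inj B∘ι≡A cover = mk⇔ restrictSingleton extendSingleton
  where
  restrictSingleton : IsSingleton B → IsSingleton A
  restrictSingleton (k , B≡δ) with cover k
  ... | inj₁ (k₀ , refl) = k₀ , λ k′ → trans (sym (B∘ι≡A k′)) (trans (B≡δ (ι k′)) (δ-injective ι-inj k₀ k′))
  ... | inj₂ Bk≡0 with () ← trans (sym Bk≡0) (trans (B≡δ k) (δ-refl k))
  extendSingleton : IsSingleton A → IsSingleton B
  extendSingleton (k₀ , A≡δ) = ι k₀ , λ k → go k (cover k)
    where
    go : ∀ k → (∃ λ k′ → ι k′ ≡ k) ⊎ B k ≡ 0 → B k ≡ δ (ι k₀) k
    go .(ι k′) (inj₁ (k′ , refl)) = trans (B∘ι≡A k′) (trans (A≡δ k′) (sym (δ-injective ι-inj k₀ k′)))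
    go k (inj₂ Bk≡0) = trans Bk≡0 (sym (δ-≢ ιk₀≢k))
      where
      ιk₀≢k : ι k₀ ≢ k
      ιk₀≢k refl = ℕₚ.1+n≢0 (begin
        1          ≡⟨ sym (δ-refl k₀) ⟩
        δ k₀ k₀    ≡⟨ sym (A≡δ k₀) ⟩
        A k₀       ≡⟨ sym (B∘ι≡A k₀) ⟩
        B (ι k₀)   ≡⟨ Bk≡0 ⟩
        0          ∎)
        where open ≡-Reasoning

record IsSubMC (C : RawMC) (S : Subfamily (size C)) : Set where
  field
    downClosed : ∀ i j → T (le C i j) → T (lookup S j) → T (lookup S i)
    singletons : ∀ i → IsSingleton (fam C i) → T (lookup S i)
open IsSubMC

T-isSubMCᵇ : ∀ C S → T (isSubMCᵇ C S) ⇔ IsSubMC C S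
T-isSubMCᵇ C S = mk⇔
  (λ t → let dc , sg = to (T-∧ {allᵇ rowᵇ (allFin _)}) t in record
    { downClosed = λ i j le-ij j∈S → to (T-⇒ᵇ (le C i j ∧ lookup S j) _)
        (to (T-allᵇ-allFin (closedᵇ i)) (to (T-allᵇ-allFin rowᵇ) dc i) j) (from T-∧ (le-ij , j∈S))
    ; singletons = λ i sg-i → to (T-⇒ᵇ (isSingletonᵇ (fam C i)) _)
        (to (T-allᵇ-allFin singᵇ) sg i) (from (T-isSingletonᵇ (fam C i)) sg-i) })
  (λ S-sub → from T-∧
    ( from (T-allᵇ-allFin rowᵇ) (λ i → from (T-allᵇ-allFin (closedᵇ i)) (λ j →
        from (T-⇒ᵇ (le C i j ∧ lookup S j) _) (λ t → let le-ij , j∈S = to T-∧ t in downClosed S-sub i j le-ij j∈S)))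
    , from (T-allᵇ-allFin singᵇ) (λ i → from (T-⇒ᵇ (isSingletonᵇ (fam C i)) _)
        (singletons S-sub i ∘ to (T-isSingletonᵇ (fam C i))))))
  where
  closedᵇ : Fin (size C) → Fin (size C) → Bool
  closedᵇ i j = (le C i j ∧ lookup S j) ⇒ᵇ lookup S i
  rowᵇ : Fin (size C) → Bool
  rowᵇ i = allᵇ (closedᵇ i) (allFin _)
  singᵇ : Fin (size C) → Bool
  singᵇ i = isSingletonᵇ (fam C i) ⇒ᵇ lookup S i

_⊆ₛ_ : ∀ {m} → Subfamily m → Subfamily m → Set
S ⊆ₛ S′ = ∀ i → T (lookup S i) → T (lookup S′ i)

T-⊆ᵇ : ∀ {m} (S S′ : Subfamily m) → T (S ⊆ᵇ S′) ⇔ S ⊆ₛ S′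
T-⊆ᵇ S S′ = mk⇔ (λ t i → to (T-⇒ᵇ _ _) (to (T-allᵇ-allFin _) t i))
                (λ S⊆S′ → from (T-allᵇ-allFin _) (λ i → from (T-⇒ᵇ _ _) (S⊆S′ i)))

module _ {m n} (u a : Subfamily m) (v b : Subfamily n) where

  ⊆ᵇ-++ : ((u Vec.++ v) ⊆ᵇ (a Vec.++ b)) ≡ ((u ⊆ᵇ a) ∧ (v ⊆ᵇ b))
  ⊆ᵇ-++ = T-injective (mk⇔ split join)
    where
    split : T ((u Vec.++ v) ⊆ᵇ (a Vec.++ b)) → T ((u ⊆ᵇ a) ∧ (v ⊆ᵇ b))
    split t = from T-∧
      ( from (T-⊆ᵇ u a) (λ i →
          subst T (Vecₚ.lookup-++ˡ a b i) ∘ uv⊆ab (i ↑ˡ n) ∘ subst T (sym (Vecₚ.lookup-++ˡ u v i)))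
      , from (T-⊆ᵇ v b) (λ j →
          subst T (Vecₚ.lookup-++ʳ a b j) ∘ uv⊆ab (m ↑ʳ j) ∘ subst T (sym (Vecₚ.lookup-++ʳ u v j))))
      where uv⊆ab = to (T-⊆ᵇ (u Vec.++ v) (a Vec.++ b)) t
    join : T ((u ⊆ᵇ a) ∧ (v ⊆ᵇ b)) → T ((u Vec.++ v) ⊆ᵇ (a Vec.++ b))
    join t = from (T-⊆ᵇ (u Vec.++ v) (a Vec.++ b)) (λ k → go k (splitView m n k))
      where
      u⊆a = to (T-⊆ᵇ u a) (proj₁ (to T-∧ t))
      v⊆b = to (T-⊆ᵇ v b) (proj₂ (to T-∧ t))
      go : ∀ k → SplitView m n k → T (lookup (u Vec.++ v) k) → T (lookup (a Vec.++ b) k)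
      go .(i ↑ˡ n) (left i)  = subst T (sym (Vecₚ.lookup-++ˡ a b i)) ∘ u⊆a i ∘ subst T (Vecₚ.lookup-++ˡ u v i)
      go .(m ↑ʳ j) (right j) = subst T (sym (Vecₚ.lookup-++ʳ a b j)) ∘ v⊆b j ∘ subst T (Vecₚ.lookup-++ʳ u v j)

T-lookup-top : ∀ {m} (i : Fin m) → T (lookup (top m) i)
T-lookup-top i = subst T (sym (Vecₚ.lookup-replicate i true)) tt

isSubMCᵇ-top : ∀ C → T (isSubMCᵇ C (top (size C)))
isSubMCᵇ-top C = from (T-isSubMCᵇ C (top (size C))) record
  { downClosed = λ i _ _ _ → T-lookup-top i
  ; singletons = λ i _ → T-lookup-top i
  }

⊆ᵇ-top : ∀ {m} (S : Subfamily m) → T (S ⊆ᵇ top m)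
⊆ᵇ-top {m} S = from (T-⊆ᵇ S (top m)) (λ i _ → T-lookup-top i)

∈-allSubfamilies : ∀ {m} (S : Subfamily m) → S ∈ allSubfamilies m
∈-allSubfamilies Vec.[]           = here refl
∈-allSubfamilies (true Vec.∷ S)  = ∈ₚ.∈-++⁺ˡ (∈ₚ.∈-map⁺ (true Vec.∷_) (∈-allSubfamilies S))
∈-allSubfamilies (false Vec.∷ S) = ∈ₚ.∈-++⁺ʳ _ (∈ₚ.∈-map⁺ (false Vec.∷_) (∈-allSubfamilies S))

∈-X⁻ : ∀ C {S} → S ∈ X C → T (isSubMCᵇ C S)
∈-X⁻ C = proj₂ ∘ ∈ₚ.∈-filter⁻ (T? ∘ isSubMCᵇ C) {xs = allSubfamilies (size C)}

interval : (C : RawMC) → Subfamily (size C) → Subfamily (size C) → List (Subfamily (size C))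
interval C x y = filterᵇ (λ z → (x ⊆ᵇ z) ∧ (z ⊆ᵇ y)) (X C)

∈-interval⁻ : ∀ C x y {z} → z ∈ interval C x y → T (isSubMCᵇ C z) × T (x ⊆ᵇ z) × T (z ⊆ᵇ y)
∈-interval⁻ C x y z∈ =
  let z∈X , x⊆z⊆y = ∈ₚ.∈-filter⁻ (T? ∘ λ z → (x ⊆ᵇ z) ∧ (z ⊆ᵇ y)) {xs = X C} z∈
      x⊆z , z⊆y = to T-∧ x⊆z⊆y
  in proj₂ (∈ₚ.∈-filter⁻ (T? ∘ isSubMCᵇ C) {xs = allSubfamilies (size C)} z∈X) , x⊆z , z⊆y

top-∈-interval : ∀ C x y → T (isSubMCᵇ C y) → T (x ⊆ᵇ y) → y ∈ interval C x y
top-∈-interval C x y y-sub x⊆y =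
  ∈ₚ.∈-filter⁺ (T? ∘ λ z → (x ⊆ᵇ z) ∧ (z ⊆ᵇ y))
    (∈ₚ.∈-filter⁺ (T? ∘ isSubMCᵇ C) (∈-allSubfamilies y) y-sub)
    (from T-∧ (x⊆y , from (T-⊆ᵇ y y) (λ _ → id)))

-- Disjoint union

module Union (C₁ C₂ : RawMC) where
  private
    m₁ = size C₁
    m₂ = size C₂
    b₁ = base C₁

  le-↑ˡ-↑ˡ : ∀ i j → le (C₁ ⊔ C₂) (i ↑ˡ m₂) (j ↑ˡ m₂) ≡ le C₁ i j
  le-↑ˡ-↑ˡ i j rewrite Finₚ.splitAt-↑ˡ m₁ i m₂ | Finₚ.splitAt-↑ˡ m₁ j m₂ = refl

  le-↑ˡ-↑ʳ : ∀ i j → le (C₁ ⊔ C₂) (i ↑ˡ m₂) (m₁ ↑ʳ j) ≡ false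
  le-↑ˡ-↑ʳ i j rewrite Finₚ.splitAt-↑ˡ m₁ i m₂ | Finₚ.splitAt-↑ʳ m₁ m₂ j = refl

  le-↑ʳ-↑ˡ : ∀ i j → le (C₁ ⊔ C₂) (m₁ ↑ʳ i) (j ↑ˡ m₂) ≡ false
  le-↑ʳ-↑ˡ i j rewrite Finₚ.splitAt-↑ʳ m₁ m₂ i | Finₚ.splitAt-↑ˡ m₁ j m₂ = refl

  le-↑ʳ-↑ʳ : ∀ i j → le (C₁ ⊔ C₂) (m₁ ↑ʳ i) (m₁ ↑ʳ j) ≡ le C₂ i j
  le-↑ʳ-↑ʳ i j rewrite Finₚ.splitAt-↑ʳ m₁ m₂ i | Finₚ.splitAt-↑ʳ m₁ m₂ j = refl

  fam-↑ˡ : ∀ i k → fam (C₁ ⊔ C₂) (i ↑ˡ m₂) k ≡ [ fam C₁ i , (λ _ → 0) ]′ (splitAt b₁ k)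
  fam-↑ˡ i k rewrite Finₚ.splitAt-↑ˡ m₁ i m₂ with splitAt b₁ k
  ... | inj₁ _ = refl
  ... | inj₂ _ = refl

  fam-↑ʳ : ∀ i k → fam (C₁ ⊔ C₂) (m₁ ↑ʳ i) k ≡ [ (λ _ → 0) , fam C₂ i ]′ (splitAt b₁ k)
  fam-↑ʳ i k rewrite Finₚ.splitAt-↑ʳ m₁ m₂ i with splitAt b₁ k
  ... | inj₁ _ = refl
  ... | inj₂ _ = refl

  isSingleton-↑ˡ : ∀ i → IsSingleton (fam (C₁ ⊔ C₂) (i ↑ˡ m₂)) ⇔ IsSingleton (fam C₁ i)
  isSingleton-↑ˡ i = IsSingleton-embed (_↑ˡ base C₂) (Finₚ.↑ˡ-injective _ _ _) onImage cover
    where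
    onImage : ∀ k → fam (C₁ ⊔ C₂) (i ↑ˡ m₂) (k ↑ˡ base C₂) ≡ fam C₁ i k
    onImage k = trans (fam-↑ˡ i _) (cong [ fam C₁ i , _ ]′ (Finₚ.splitAt-↑ˡ b₁ k _))
    cover : ∀ k → (∃ λ k′ → k′ ↑ˡ base C₂ ≡ k) ⊎ fam (C₁ ⊔ C₂) (i ↑ˡ m₂) k ≡ 0
    cover k with splitView b₁ (base C₂) k
    ... | left k′  = inj₁ (k′ , refl)
    ... | right k′ = inj₂ (trans (fam-↑ˡ i _) (cong [ fam C₁ i , _ ]′ (Finₚ.splitAt-↑ʳ b₁ _ k′)))

  isSingleton-↑ʳ : ∀ i → IsSingleton (fam (C₁ ⊔ C₂) (m₁ ↑ʳ i)) ⇔ IsSingleton (fam C₂ i)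
  isSingleton-↑ʳ i = IsSingleton-embed (b₁ ↑ʳ_) (Finₚ.↑ʳ-injective _ _ _) onImage cover
    where
    onImage : ∀ k → fam (C₁ ⊔ C₂) (m₁ ↑ʳ i) (b₁ ↑ʳ k) ≡ fam C₂ i k
    onImage k = trans (fam-↑ʳ i _) (cong [ _ , fam C₂ i ]′ (Finₚ.splitAt-↑ʳ b₁ _ k))
    cover : ∀ k → (∃ λ k′ → b₁ ↑ʳ k′ ≡ k) ⊎ fam (C₁ ⊔ C₂) (m₁ ↑ʳ i) k ≡ 0
    cover k with splitView b₁ (base C₂) k
    ... | left k′  = inj₂ (trans (fam-↑ʳ i _) (cong [ _ , fam C₂ i ]′ (Finₚ.splitAt-↑ˡ b₁ k′ _)))
    ... | right k′ = inj₁ (k′ , refl)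

  module _ (u : Subfamily m₁) (v : Subfamily m₂) where
    private
      uv = u Vec.++ v
      ∈uv⇒∈u : ∀ {i} → T (lookup uv (i ↑ˡ m₂)) → T (lookup u i)
      ∈uv⇒∈u = subst T (Vecₚ.lookup-++ˡ u v _)
      ∈u⇒∈uv : ∀ {i} → T (lookup u i) → T (lookup uv (i ↑ˡ m₂))
      ∈u⇒∈uv = subst T (sym (Vecₚ.lookup-++ˡ u v _))
      ∈uv⇒∈v : ∀ {i} → T (lookup uv (m₁ ↑ʳ i)) → T (lookup v i)
      ∈uv⇒∈v = subst T (Vecₚ.lookup-++ʳ u v _)
      ∈v⇒∈uv : ∀ {i} → T (lookup v i) → T (lookup uv (m₁ ↑ʳ i))
      ∈v⇒∈uv = subst T (sym (Vecₚ.lookup-++ʳ u v _))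

    IsSubMC-⊔ : IsSubMC (C₁ ⊔ C₂) uv ⇔ (IsSubMC C₁ u × IsSubMC C₂ v)
    IsSubMC-⊔ = mk⇔ split join
      where
      split : IsSubMC (C₁ ⊔ C₂) uv → IsSubMC C₁ u × IsSubMC C₂ v
      split S = record
          { downClosed = λ i j le-ij →
              ∈uv⇒∈u ∘ downClosed S (i ↑ˡ m₂) (j ↑ˡ m₂) (subst T (sym (le-↑ˡ-↑ˡ i j)) le-ij) ∘ ∈u⇒∈uv
          ; singletons = λ i → ∈uv⇒∈u ∘ singletons S (i ↑ˡ m₂) ∘ from (isSingleton-↑ˡ i) }
        , record
          { downClosed = λ i j le-ij →
              ∈uv⇒∈v ∘ downClosed S (m₁ ↑ʳ i) (m₁ ↑ʳ j) (subst T (sym (le-↑ʳ-↑ʳ i j)) le-ij) ∘ ∈v⇒∈uv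
          ; singletons = λ i → ∈uv⇒∈v ∘ singletons S (m₁ ↑ʳ i) ∘ from (isSingleton-↑ʳ i) }
      join : IsSubMC C₁ u × IsSubMC C₂ v → IsSubMC (C₁ ⊔ C₂) uv
      join (S₁ , S₂) = record
        { downClosed = λ i j → closed (splitView m₁ m₂ i) (splitView m₁ m₂ j)
        ; singletons = λ i → hasSingletons (splitView m₁ m₂ i) }
        where
        closed : ∀ {i j} → SplitView m₁ m₂ i → SplitView m₁ m₂ j →
                 T (le (C₁ ⊔ C₂) i j) → T (lookup uv j) → T (lookup uv i)
        closed (left i)  (left j)  le-ij = ∈u⇒∈uv ∘ downClosed S₁ i j (subst T (le-↑ˡ-↑ˡ i j) le-ij) ∘ ∈uv⇒∈u
        closed (right i) (right j) le-ij = ∈v⇒∈uv ∘ downClosed S₂ i j (subst T (le-↑ʳ-↑ʳ i j) le-ij) ∘ ∈uv⇒∈v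
        closed (left i)  (right j) le-ij = ⊥-elim (subst T (le-↑ˡ-↑ʳ i j) le-ij)
        closed (right i) (left j)  le-ij = ⊥-elim (subst T (le-↑ʳ-↑ˡ i j) le-ij)
        hasSingletons : ∀ {i} → SplitView m₁ m₂ i → IsSingleton (fam (C₁ ⊔ C₂) i) → T (lookup uv i)
        hasSingletons (left i)  = ∈u⇒∈uv ∘ singletons S₁ i ∘ to (isSingleton-↑ˡ i)
        hasSingletons (right i) = ∈v⇒∈uv ∘ singletons S₂ i ∘ to (isSingleton-↑ʳ i)

    isSubMCᵇ-⊔ : isSubMCᵇ (C₁ ⊔ C₂) uv ≡ (isSubMCᵇ C₁ u ∧ isSubMCᵇ C₂ v)
    isSubMCᵇ-⊔ = T-injective (mk⇔
      (λ t → let S₁ , S₂ = to IsSubMC-⊔ (to (T-isSubMCᵇ _ uv) t)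
             in from T-∧ (from (T-isSubMCᵇ C₁ u) S₁ , from (T-isSubMCᵇ C₂ v) S₂))
      (λ t → let t₁ , t₂ = to (T-∧ {isSubMCᵇ C₁ u}) t
             in from (T-isSubMCᵇ _ uv) (from IsSubMC-⊔ (to (T-isSubMCᵇ C₁ u) t₁ , to (T-isSubMCᵇ C₂ v) t₂))))

    T-isSubMCᵇ-⊔ : T (isSubMCᵇ (C₁ ⊔ C₂) uv) ⇔ (T (isSubMCᵇ C₁ u) × T (isSubMCᵇ C₂ v))
    T-isSubMCᵇ-⊔ = subst (λ b → T b ⇔ (T (isSubMCᵇ C₁ u) × T (isSubMCᵇ C₂ v))) (sym isSubMCᵇ-⊔) T-∧

open Union public

allSubfamilies-+ : ∀ m n → allSubfamilies (m + n) ≡ cartesianProductWith Vec._++_ (allSubfamilies m) (allSubfamilies n)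
allSubfamilies-+ zero    n = sym (trans (Listₚ.++-identityʳ _) (Listₚ.map-id _))
allSubfamilies-+ (suc m) n = begin
    map (true Vec.∷_) (allSubfamilies (m + n)) ++ map (false Vec.∷_) (allSubfamilies (m + n))
  ≡⟨ cong₂ _++_ (prepend true) (prepend false) ⟩
    cartesianProductWith Vec._++_ (map (true Vec.∷_) (allSubfamilies m)) (allSubfamilies n)
      ++ cartesianProductWith Vec._++_ (map (false Vec.∷_) (allSubfamilies m)) (allSubfamilies n)
  ≡⟨ cartesianProductWith-++ Vec._++_ (map (true Vec.∷_) (allSubfamilies m)) _ _ ⟨
    cartesianProductWith Vec._++_ (allSubfamilies (suc m)) (allSubfamilies n)
  ∎
  where
  open ≡-Reasoning
  prepend : ∀ x → map (x Vec.∷_) (allSubfamilies (m + n))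
                ≡ cartesianProductWith Vec._++_ (map (x Vec.∷_) (allSubfamilies m)) (allSubfamilies n)
  prepend x = begin
      map (x Vec.∷_) (allSubfamilies (m + n))
    ≡⟨ cong (map (x Vec.∷_)) (allSubfamilies-+ m n) ⟩
      map (x Vec.∷_) (cartesianProductWith Vec._++_ (allSubfamilies m) (allSubfamilies n))
    ≡⟨ map-cartesianProductWith (x Vec.∷_) Vec._++_ (allSubfamilies m) (allSubfamilies n) ⟩
      cartesianProductWith (λ u v → x Vec.∷ (u Vec.++ v)) (allSubfamilies m) (allSubfamilies n)
    ≡⟨ cartesianProductWith-mapˡ Vec._++_ (x Vec.∷_) (allSubfamilies m) (allSubfamilies n) ⟨
      cartesianProductWith Vec._++_ (map (x Vec.∷_) (allSubfamilies m)) (allSubfamilies n)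
    ∎

X-⊔ : ∀ C₁ C₂ → X (C₁ ⊔ C₂) ≡ cartesianProductWith Vec._++_ (X C₁) (X C₂)
X-⊔ C₁ C₂ = trans (cong (filterᵇ (isSubMCᵇ (C₁ ⊔ C₂))) (allSubfamilies-+ (size C₁) (size C₂)))
  (filterᵇ-cartesianProductWith _ _ _ Vec._++_ (isSubMCᵇ-⊔ C₁ C₂) (allSubfamilies (size C₁)) (allSubfamilies (size C₂)))

interval-⊔ : ∀ C₁ C₂ (u a : Subfamily (size C₁)) (v b : Subfamily (size C₂)) →
  interval (C₁ ⊔ C₂) (u Vec.++ v) (a Vec.++ b) ≡ cartesianProductWith Vec._++_ (interval C₁ u a) (interval C₂ v b)
interval-⊔ C₁ C₂ u a v b = trans (cong (filterᵇ _) (X-⊔ C₁ C₂))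
  (filterᵇ-cartesianProductWith _ _ _ Vec._++_ between-++ (X C₁) (X C₂))
  where
  open Algebra.Properties.CommutativeSemigroup (CommutativeMonoid.commutativeSemigroup Boolₚ.∧-commutativeMonoid)
    using (interchange)
  between-++ : ∀ w w′ → (((u Vec.++ v) ⊆ᵇ (w Vec.++ w′)) ∧ ((w Vec.++ w′) ⊆ᵇ (a Vec.++ b)))
                      ≡ (((u ⊆ᵇ w) ∧ (w ⊆ᵇ a)) ∧ ((v ⊆ᵇ w′) ∧ (w′ ⊆ᵇ b)))
  between-++ w w′ = trans (cong₂ _∧_ (⊆ᵇ-++ u w v w′) (⊆ᵇ-++ w a w′ b)) (interchange (u ⊆ᵇ w) (v ⊆ᵇ w′) (w ⊆ᵇ a) (w′ ⊆ᵇ b))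

-- Möbius functions

_≟ₛ_ : ∀ {m} → DecidableEquality (Subfamily m)
_≟ₛ_ = Vecₚ.≡-dec Boolₚ._≟_

∣_∣ : ∀ {m} → Subfamily m → ℕ
∣ S ∣ = Vec.countᵇ id S

∣∣-mono-≤ : ∀ {m} (S S′ : Subfamily m) → S ⊆ₛ S′ → ∣ S ∣ ≤ ∣ S′ ∣
∣∣-mono-≤ Vec.[]            Vec.[]            _    = z≤n
∣∣-mono-≤ (true Vec.∷ S)    (true Vec.∷ S′)   S⊆S′ = s≤s (∣∣-mono-≤ S S′ (S⊆S′ ∘ Fin.suc))
∣∣-mono-≤ (true Vec.∷ S)    (false Vec.∷ S′)  S⊆S′ = ⊥-elim (S⊆S′ Fin.zero tt)
∣∣-mono-≤ (false Vec.∷ S)   (true Vec.∷ S′)   S⊆S′ = ℕₚ.m≤n⇒m≤1+n (∣∣-mono-≤ S S′ (S⊆S′ ∘ Fin.suc))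
∣∣-mono-≤ (false Vec.∷ S)   (false Vec.∷ S′)  S⊆S′ = ∣∣-mono-≤ S S′ (S⊆S′ ∘ Fin.suc)

∣∣-mono-< : ∀ {m} (S S′ : Subfamily m) → S ⊆ₛ S′ → S ≢ S′ → ∣ S ∣ < ∣ S′ ∣
∣∣-mono-< Vec.[]            Vec.[]            _    S≢S′ = ⊥-elim (S≢S′ refl)
∣∣-mono-< (true Vec.∷ S)    (true Vec.∷ S′)   S⊆S′ S≢S′ = s≤s (∣∣-mono-< S S′ (S⊆S′ ∘ Fin.suc) (S≢S′ ∘ cong (true Vec.∷_)))
∣∣-mono-< (true Vec.∷ S)    (false Vec.∷ S′)  S⊆S′ _    = ⊥-elim (S⊆S′ Fin.zero tt)
∣∣-mono-< (false Vec.∷ S)   (true Vec.∷ S′)   S⊆S′ _    = s≤s (∣∣-mono-≤ S S′ (S⊆S′ ∘ Fin.suc))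
∣∣-mono-< (false Vec.∷ S)   (false Vec.∷ S′)  S⊆S′ S≢S′ = ∣∣-mono-< S S′ (S⊆S′ ∘ Fin.suc) (S≢S′ ∘ cong (false Vec.∷_))

Möbius-unique : ∀ C {μ ν} → IsMöbius C μ → IsMöbius C ν →
  ∀ x y → T (isSubMCᵇ C x) → T (isSubMCᵇ C y) → T (x ⊆ᵇ y) → μ x y ≡ ν x y
Möbius-unique C {μ} {ν} μ-möb ν-möb x y = go (suc ∣ y ∣) y ℕₚ.≤-refl
  where
  go : ∀ n y → ∣ y ∣ < n → T (isSubMCᵇ C x) → T (isSubMCᵇ C y) → T (x ⊆ᵇ y) → μ x y ≡ ν x y
  go (suc n) y ∣y∣<n x-sub y-sub x⊆y with x ≟ₛ y
  ... | yes refl = trans (IsMöbius.diag μ-möb x x-sub) (sym (IsMöbius.diag ν-möb x x-sub))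
  ... | no x≢y = ≡-from-sums _≟ₛ_ (μ x) (ν x) y (top-∈-interval C x y y-sub x⊆y) below
      (trans (IsMöbius.offDiag μ-möb x y x-sub y-sub x⊆y x≢y) (sym (IsMöbius.offDiag ν-möb x y x-sub y-sub x⊆y x≢y)))
    where
    below : ∀ {z} → z ∈ interval C x y → y ≢ z → μ x z ≡ ν x z
    below {z} z∈ y≢z =
      let z-sub , x⊆z , z⊆y = ∈-interval⁻ C x y z∈
          ∣z∣<∣y∣ = ∣∣-mono-< z y (to (T-⊆ᵇ z y) z⊆y) (y≢z ∘ sym)
      in go n z (ℕₚ.<-≤-trans ∣z∣<∣y∣ (ℕₚ.≤-pred ∣y∣<n)) x-sub z-sub x⊆z

productMobFun : ∀ C₁ C₂ → MobFun C₁ → MobFun C₂ → MobFun (C₁ ⊔ C₂)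
productMobFun C₁ C₂ μ₁ μ₂ x y =
  μ₁ (Vec.take (size C₁) x) (Vec.take (size C₁) y) ℤ.* μ₂ (Vec.drop (size C₁) x) (Vec.drop (size C₁) y)

module _ (C₁ C₂ : RawMC) (μ₁ : MobFun C₁) (μ₂ : MobFun C₂) where

  productMobFun-++ : ∀ u a v b → productMobFun C₁ C₂ μ₁ μ₂ (u Vec.++ v) (a Vec.++ b) ≡ μ₁ u a ℤ.* μ₂ v b
  productMobFun-++ u a v b rewrite take-++ u v | take-++ a b | drop-++ u v | drop-++ a b = refl

  IsMöbius-product : IsMöbius C₁ μ₁ → IsMöbius C₂ μ₂ → IsMöbius (C₁ ⊔ C₂) (productMobFun C₁ C₂ μ₁ μ₂)
  IsMöbius-product μ₁-möb μ₂-möb = record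
    { diag    = ++-elim (λ x → _ → μ x x ≡ + 1) diag
    ; offDiag = ++-elim (λ x → ∀ y → _ → _ → _ → _ → _) λ u v → ++-elim _ (offDiag u v) }
    where
    μ = productMobFun C₁ C₂ μ₁ μ₂
    sub-⊔ : ∀ u v → T (isSubMCᵇ (C₁ ⊔ C₂) (u Vec.++ v)) → T (isSubMCᵇ C₁ u) × T (isSubMCᵇ C₂ v)
    sub-⊔ u v = to (T-isSubMCᵇ-⊔ C₁ C₂ u v)
    diag : ∀ u v → T (isSubMCᵇ (C₁ ⊔ C₂) (u Vec.++ v)) → μ (u Vec.++ v) (u Vec.++ v) ≡ + 1
    diag u v uv-sub = begin
        μ (u Vec.++ v) (u Vec.++ v)  ≡⟨ productMobFun-++ u u v v ⟩
        μ₁ u u ℤ.* μ₂ v v            ≡⟨ cong₂ ℤ._*_ (IsMöbius.diag μ₁-möb u (proj₁ (sub-⊔ u v uv-sub)))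
                                                     (IsMöbius.diag μ₂-möb v (proj₂ (sub-⊔ u v uv-sub))) ⟩
        + 1                          ∎
      where open ≡-Reasoning
    offDiag : ∀ u v a b → T (isSubMCᵇ (C₁ ⊔ C₂) (u Vec.++ v)) → T (isSubMCᵇ (C₁ ⊔ C₂) (a Vec.++ b)) →
              T ((u Vec.++ v) ⊆ᵇ (a Vec.++ b)) → u Vec.++ v ≢ a Vec.++ b →
              sumℤ (map (μ (u Vec.++ v)) (interval (C₁ ⊔ C₂) (u Vec.++ v) (a Vec.++ b))) ≡ + 0
    offDiag u v a b uv-sub ab-sub uv⊆ab uv≢ab = begin
        sumℤ (map (μ (u Vec.++ v)) (interval (C₁ ⊔ C₂) (u Vec.++ v) (a Vec.++ b)))
      ≡⟨ cong (sumℤ ∘ map (μ (u Vec.++ v))) (interval-⊔ C₁ C₂ u a v b) ⟩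
        sumℤ (map (μ (u Vec.++ v)) (cartesianProductWith Vec._++_ (interval C₁ u a) (interval C₂ v b)))
      ≡⟨ cong sumℤ (trans (map-cartesianProductWith _ Vec._++_ (interval C₁ u a) (interval C₂ v b))
                          (cartesianProductWith-cong {xs = interval C₁ u a} {interval C₂ v b}
                            (λ {w} {w′} _ _ → productMobFun-++ u w v w′))) ⟩
        sumℤ (cartesianProductWith (λ w w′ → μ₁ u w ℤ.* μ₂ v w′) (interval C₁ u a) (interval C₂ v b))
      ≡⟨ sumℤ-cartesianProductWith-* (μ₁ u) (μ₂ v) (interval C₁ u a) (interval C₂ v b) ⟩
        sumℤ (map (μ₁ u) (interval C₁ u a)) ℤ.* sumℤ (map (μ₂ v) (interval C₂ v b))
      ≡⟨ factor-vanishes ⟩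
        + 0
      ∎
      where
      open ≡-Reasoning
      u⊆a×v⊆b = to T-∧ (subst T (⊆ᵇ-++ u a v b) uv⊆ab)
      Σ₁ = sumℤ (map (μ₁ u) (interval C₁ u a))
      Σ₂ = sumℤ (map (μ₂ v) (interval C₂ v b))
      factor-vanishes : Σ₁ ℤ.* Σ₂ ≡ + 0
      factor-vanishes with u ≟ₛ a
      ... | no u≢a = trans (cong (ℤ._* Σ₂) (IsMöbius.offDiag μ₁-möb u a (proj₁ (sub-⊔ u v uv-sub))
                                             (proj₁ (sub-⊔ a b ab-sub)) (proj₁ u⊆a×v⊆b) u≢a))
                           (ℤₚ.*-zeroˡ Σ₂)
      ... | yes refl = trans (cong (Σ₁ ℤ.*_) (IsMöbius.offDiag μ₂-möb v b (proj₂ (sub-⊔ u v uv-sub))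
                                               (proj₂ (sub-⊔ a b ab-sub)) (proj₂ u⊆a×v⊆b) (uv≢ab ∘ cong (u Vec.++_))))
                             (ℤₚ.*-zeroʳ Σ₁)

Möbius-⊔ : ∀ C₁ C₂ {μ₁ μ₂ μ} → IsMöbius C₁ μ₁ → IsMöbius C₂ μ₂ → IsMöbius (C₁ ⊔ C₂) μ →
  ∀ {a b c d} → T (isSubMCᵇ C₁ a) → T (isSubMCᵇ C₂ b) → T (isSubMCᵇ C₁ c) → T (isSubMCᵇ C₂ d) →
  T (a ⊆ᵇ c) → T (b ⊆ᵇ d) → μ (a Vec.++ b) (c Vec.++ d) ≡ μ₁ a c ℤ.* μ₂ b d
Möbius-⊔ C₁ C₂ {μ₁} {μ₂} μ₁-möb μ₂-möb μ-möb {a} {b} {c} {d} a-sub b-sub c-sub d-sub a⊆c b⊆d =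
  trans (Möbius-unique (C₁ ⊔ C₂) μ-möb (IsMöbius-product C₁ C₂ μ₁ μ₂ μ₁-möb μ₂-möb) (a Vec.++ b) (c Vec.++ d)
           (from (T-isSubMCᵇ-⊔ C₁ C₂ a b) (a-sub , b-sub)) (from (T-isSubMCᵇ-⊔ C₁ C₂ c d) (c-sub , d-sub))
           (subst T (sym (⊆ᵇ-++ a c b d)) (from T-∧ (a⊆c , b⊆d))))
        (productMobFun-++ C₁ C₂ μ₁ μ₂ a c b d)

-- Restriction

restrictTo : (C : RawMC) → List (Fin (size C)) → RawMC
restrictTo C L = mkMC (base C) (length L) (λ j → fam C (List.lookup L j))
                      (λ j j′ → le C (List.lookup L j) (List.lookup L j′))

support : ∀ {m} → Subfamily m → List (Fin m)
support S = filterᵇ (lookup S) (allFin _)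

support-++ : ∀ {m n} (u : Subfamily m) (v : Subfamily n) →
  support (u Vec.++ v) ≡ map (_↑ˡ n) (support u) ++ map (m ↑ʳ_) (support v)
support-++ {m} {n} u v = begin
    filterᵇ (lookup uv) (allFin (m + n))
  ≡⟨ cong (filterᵇ (lookup uv)) (allFin-+ m n) ⟩
    filterᵇ (lookup uv) (map (_↑ˡ n) (allFin m) ++ map (m ↑ʳ_) (allFin n))
  ≡⟨ Listₚ.filter-++ (T? ∘ lookup uv) (map (_↑ˡ n) (allFin m)) _ ⟩
    filterᵇ (lookup uv) (map (_↑ˡ n) (allFin m)) ++ filterᵇ (lookup uv) (map (m ↑ʳ_) (allFin n))
  ≡⟨ cong₂ _++_ (filterᵇ-map (lookup uv) (_↑ˡ n) (allFin m)) (filterᵇ-map (lookup uv) (m ↑ʳ_) (allFin n)) ⟩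
    map (_↑ˡ n) (filterᵇ (lookup uv ∘ (_↑ˡ n)) (allFin m)) ++ map (m ↑ʳ_) (filterᵇ (lookup uv ∘ (m ↑ʳ_)) (allFin n))
  ≡⟨ cong₂ _++_ (cong (map (_↑ˡ n)) (filterᵇ-cong (Vecₚ.lookup-++ˡ u v) (allFin m)))
                (cong (map (m ↑ʳ_)) (filterᵇ-cong (Vecₚ.lookup-++ʳ u v) (allFin n))) ⟩
    map (_↑ˡ n) (support u) ++ map (m ↑ʳ_) (support v)
  ∎
  where
  open ≡-Reasoning
  uv = u Vec.++ v

module _ {A B C : Set} (f : A → C) (g : B → C) where

  lookup-map-cast : ∀ ys (j : Fin (length ys)) .(eq : length ys ≡ length (map g ys)) →
    List.lookup (map g ys) (Fin.cast eq j) ≡ g (List.lookup ys j)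
  lookup-map-cast (y ∷ ys) Fin.zero    eq = refl
  lookup-map-cast (y ∷ ys) (Fin.suc j) eq = lookup-map-cast ys j (ℕₚ.suc-injective eq)

  lookup-map-++-↑ˡ : ∀ xs ys (i : Fin (length xs)) .(eq : length xs + length ys ≡ length (map f xs ++ map g ys)) →
    List.lookup (map f xs ++ map g ys) (Fin.cast eq (i ↑ˡ length ys)) ≡ f (List.lookup xs i)
  lookup-map-++-↑ˡ (x ∷ xs) ys Fin.zero    eq = refl
  lookup-map-++-↑ˡ (x ∷ xs) ys (Fin.suc i) eq = lookup-map-++-↑ˡ xs ys i (ℕₚ.suc-injective eq)

  lookup-map-++-↑ʳ : ∀ xs ys (j : Fin (length ys)) .(eq : length xs + length ys ≡ length (map f xs ++ map g ys)) →
    List.lookup (map f xs ++ map g ys) (Fin.cast eq (length xs ↑ʳ j)) ≡ g (List.lookup ys j)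
  lookup-map-++-↑ʳ []       ys j eq = lookup-map-cast ys j eq
  lookup-map-++-↑ʳ (x ∷ xs) ys j eq = lookup-map-++-↑ʳ xs ys j (ℕₚ.suc-injective eq)

cast-↔ : ∀ {m n} → .(m ≡ n) → Fin m ↔ Fin n
cast-↔ eq = mk↔ₛ′ (Fin.cast eq) (Fin.cast (sym eq)) (Finₚ.cast-involutive eq (sym eq)) (Finₚ.cast-involutive (sym eq) eq)

restrictTo-⊔ : ∀ C₁ C₂ (I₁ : List (Fin (size C₁))) (I₂ : List (Fin (size C₂))) →
  (restrictTo C₁ I₁ ⊔ restrictTo C₂ I₂) ≅ restrictTo (C₁ ⊔ C₂) (map (_↑ˡ size C₂) I₁ ++ map (size C₁ ↑ʳ_) I₂)
restrictTo-⊔ C₁ C₂ I₁ I₂ = record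
  { σ      = ↔-id _
  ; τ      = cast-↔ length-I
  ; famIso = λ j k → famIso (splitView (length I₁) (length I₂) j) k
  ; leIso  = λ j j′ → leIso (splitView (length I₁) (length I₂) j) (splitView (length I₁) (length I₂) j′)
  }
  where
  C = C₁ ⊔ C₂
  D₁ = restrictTo C₁ I₁
  D₂ = restrictTo C₂ I₂
  I = map (_↑ˡ size C₂) I₁ ++ map (size C₁ ↑ʳ_) I₂
  length-I : length I₁ + length I₂ ≡ length I
  length-I = sym (trans (Listₚ.length-++ (map (_↑ˡ size C₂) I₁))
                        (cong₂ _+_ (Listₚ.length-map _ I₁) (Listₚ.length-map _ I₂)))
  lookupˡ : ∀ i → List.lookup I (Fin.cast length-I (i ↑ˡ length I₂)) ≡ List.lookup I₁ i ↑ˡ size C₂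
  lookupˡ i = lookup-map-++-↑ˡ (_↑ˡ size C₂) (size C₁ ↑ʳ_) I₁ I₂ i length-I
  lookupʳ : ∀ j → List.lookup I (Fin.cast length-I (length I₁ ↑ʳ j)) ≡ size C₁ ↑ʳ List.lookup I₂ j
  lookupʳ j = lookup-map-++-↑ʳ (_↑ˡ size C₂) (size C₁ ↑ʳ_) I₁ I₂ j length-I
  famIso : ∀ {j} → SplitView (length I₁) (length I₂) j → ∀ k →
           fam C (List.lookup I (Fin.cast length-I j)) k ≡ fam (D₁ ⊔ D₂) j k
  famIso (left i) k = trans (cong (λ i′ → fam C i′ k) (lookupˡ i))
                            (trans (Union.fam-↑ˡ C₁ C₂ _ k) (sym (Union.fam-↑ˡ D₁ D₂ i k)))
  famIso (right j) k = trans (cong (λ j′ → fam C j′ k) (lookupʳ j))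
                             (trans (Union.fam-↑ʳ C₁ C₂ _ k) (sym (Union.fam-↑ʳ D₁ D₂ j k)))
  leIso : ∀ {j j′} → SplitView (length I₁) (length I₂) j → SplitView (length I₁) (length I₂) j′ →
          le C (List.lookup I (Fin.cast length-I j)) (List.lookup I (Fin.cast length-I j′)) ≡ le (D₁ ⊔ D₂) j j′
  leIso (left i) (left i′) = trans (cong₂ (le C) (lookupˡ i) (lookupˡ i′))
    (trans (Union.le-↑ˡ-↑ˡ C₁ C₂ _ _) (sym (Union.le-↑ˡ-↑ˡ D₁ D₂ i i′)))
  leIso (left i) (right j′) = trans (cong₂ (le C) (lookupˡ i) (lookupʳ j′))
    (trans (Union.le-↑ˡ-↑ʳ C₁ C₂ _ _) (sym (Union.le-↑ˡ-↑ʳ D₁ D₂ i j′)))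
  leIso (right j) (left i′) = trans (cong₂ (le C) (lookupʳ j) (lookupˡ i′))
    (trans (Union.le-↑ʳ-↑ˡ C₁ C₂ _ _) (sym (Union.le-↑ʳ-↑ˡ D₁ D₂ j i′)))
  leIso (right j) (right j′) = trans (cong₂ (le C) (lookupʳ j) (lookupʳ j′))
    (trans (Union.le-↑ʳ-↑ʳ C₁ C₂ _ _) (sym (Union.le-↑ʳ-↑ʳ D₁ D₂ j j′)))

restrict-⊔ : ∀ C₁ C₂ u v → (restrict C₁ u ⊔ restrict C₂ v) ≅ restrict (C₁ ⊔ C₂) (u Vec.++ v)
restrict-⊔ C₁ C₂ u v =
  subst ((restrict C₁ u ⊔ restrict C₂ v) ≅_) (cong (restrictTo (C₁ ⊔ C₂)) (sym (support-++ u v)))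
        (restrictTo-⊔ C₁ C₂ (support u) (support v))

-- Evaluation in H

weight : (RawMC → ℤ) → ℤ × RawMC → ℤ
weight f (a , C) = a ℤ.* f C

multiply : ℤ × RawMC → ℤ × RawMC → ℤ × RawMC
multiply (a , C) (b , D) = (a ℤ.* b , C ⊔ D)

·H-as-cartesianProductWith : ∀ x y → (x ·H y) ≡ cartesianProductWith multiply x y
·H-as-cartesianProductWith []      y = refl
·H-as-cartesianProductWith (t ∷ x) y = cong (map (multiply t) y ++_) (·H-as-cartesianProductWith x y)

module _ (f : RawMC → ℤ) where

  evalH-as-sum : ∀ xs → evalH f xs ≡ sumℤ (map (weight f) xs)
  evalH-as-sum xs = sym (Listₚ.foldr-map ℤ._+_ (weight f) (+ 0) xs)

  evalH-map-cartesianProductWith : ∀ {A B C : Set} (F : C → ℤ × RawMC) (g : A → B → C) xs ys →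
    evalH f (map F (cartesianProductWith g xs ys)) ≡ sumℤ (cartesianProductWith (λ x y → weight f (F (g x y))) xs ys)
  evalH-map-cartesianProductWith F g xs ys = trans (evalH-as-sum (map F (cartesianProductWith g xs ys)))
    (cong sumℤ (trans (sym (Listₚ.map-∘ (cartesianProductWith g xs ys))) (map-cartesianProductWith (weight f ∘ F) g xs ys)))

  evalH-·H-map : ∀ {A B : Set} (F : A → ℤ × RawMC) (G : B → ℤ × RawMC) xs ys →
    evalH f (map F xs ·H map G ys) ≡ sumℤ (cartesianProductWith (λ x y → weight f (multiply (F x) (G y))) xs ys)
  evalH-·H-map F G xs ys = begin
      evalH f (map F xs ·H map G ys)
    ≡⟨ evalH-as-sum (map F xs ·H map G ys) ⟩
      sumℤ (map (weight f) (map F xs ·H map G ys))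
    ≡⟨ cong (sumℤ ∘ map (weight f)) (·H-as-cartesianProductWith (map F xs) (map G ys)) ⟩
      sumℤ (map (weight f) (cartesianProductWith multiply (map F xs) (map G ys)))
    ≡⟨ cong sumℤ (map-cartesianProductWith (weight f) multiply (map F xs) (map G ys)) ⟩
      sumℤ (cartesianProductWith (λ s t → weight f (multiply s t)) (map F xs) (map G ys))
    ≡⟨ cong sumℤ (trans (cartesianProductWith-mapˡ _ F xs (map G ys)) (cartesianProductWith-mapʳ _ G xs ys)) ⟩
      sumℤ (cartesianProductWith (λ x y → weight f (multiply (F x) (G y))) xs ys)
    ∎
    where open ≡-Reasoning

summand : (C : RawMC) → MobFun C → Subfamily (size C) → ℤ × RawMC
summand C μ S = (μ S (top (size C)) , restrict C S)

proposition4p4 : (C₁ C₂ : RawMC) → IsMultiComplex C₁ → IsMultiComplex C₂ →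
    (μ₁ : MobFun C₁) → IsMöbius C₁ μ₁ →
    (μ₂ : MobFun C₂) → IsMöbius C₂ μ₂ →
    (μ : MobFun (C₁ ⊔ C₂)) → IsMöbius (C₁ ⊔ C₂) μ →
    P (C₁ ⊔ C₂) μ ≈H (P C₁ μ₁ ·H P C₂ μ₂)
proposition4p4 C₁ C₂ _ _ μ₁ μ₁-möb μ₂ μ₂-möb μ μ-möb f f-invariant = begin
    evalH f (map (summand (C₁ ⊔ C₂) μ) (X (C₁ ⊔ C₂)))
  ≡⟨ cong (evalH f ∘ map (summand (C₁ ⊔ C₂) μ)) (X-⊔ C₁ C₂) ⟩
    evalH f (map (summand (C₁ ⊔ C₂) μ) (cartesianProductWith Vec._++_ (X C₁) (X C₂)))
  ≡⟨ evalH-map-cartesianProductWith f (summand (C₁ ⊔ C₂) μ) Vec._++_ (X C₁) (X C₂) ⟩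
    sumℤ (cartesianProductWith (λ a b → weight f (summand (C₁ ⊔ C₂) μ (a Vec.++ b))) (X C₁) (X C₂))
  ≡⟨ cong sumℤ (cartesianProductWith-cong summand-⊔) ⟩
    sumℤ (cartesianProductWith (λ a b → weight f (multiply (summand C₁ μ₁ a) (summand C₂ μ₂ b))) (X C₁) (X C₂))
  ≡⟨ evalH-·H-map f (summand C₁ μ₁) (summand C₂ μ₂) (X C₁) (X C₂) ⟨
    evalH f (P C₁ μ₁ ·H P C₂ μ₂)
  ∎
  where
  open ≡-Reasoning
  summand-⊔ : ∀ {a b} → a ∈ X C₁ → b ∈ X C₂ →
    weight f (summand (C₁ ⊔ C₂) μ (a Vec.++ b)) ≡ weight f (multiply (summand C₁ μ₁ a) (summand C₂ μ₂ b))
  summand-⊔ {a} {b} a∈X b∈X = cong₂ ℤ._*_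
    (trans (cong (μ (a Vec.++ b)) (top-+ (size C₁) (size C₂)))
           (Möbius-⊔ C₁ C₂ μ₁-möb μ₂-möb μ-möb (∈-X⁻ C₁ a∈X) (∈-X⁻ C₂ b∈X) (isSubMCᵇ-top C₁) (isSubMCᵇ-top C₂)
                     (⊆ᵇ-top a) (⊆ᵇ-top b)))
    (sym (f-invariant _ _ (restrict-⊔ C₁ C₂ a b)))
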